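{- Let $(a_i)_{i\ge1},(b_i)_{i\ge1}$ be nonnegative integers with $a_1=b_1=1$, let $(c_i)_{i\ge1}$ be integers, and fix a sign $\epsilon\in\{+1,-1\}$. Define Laurent polynomials $F_n(z)$ by \[ \sum_{n\ge0}F_n(z)q^n=\prod_{i\ge1}(1-zq^i)^{ -a_i}(1-z^{ -1}q^i)^{ -b_i}(1+\epsilon q^i)^{c_i}. \] Then for all $n\ge0$ and $0\le k\le n/2$, \[ [z^{n-k}]F_n(z)=[z^{n+1-k}]F_{n+1}(z),\qquad [z^{ -(n-k)}]F_n(z)=[z^{ -(n+1-k)}]F_{n+1}(z). \]
   Context: $[z^k]$ denotes the coefficient of $z^k$ in a Laurent polynomial. -}

module Defs where

open import Data.Nat using (ℕ; zero; suc; _*_; _∸_) renaming (_+_ to _+ℕ_; _≟_ to _≟ℕ_)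
open import Data.Integer using (ℤ; +_; -[1+_]; -_) renaming (_+_ to _+ℤ_; _*_ to _*ℤ_)
open import Data.List using (List; []; _∷_; map; foldr; upTo)
open import Data.Bool using (if_then_else_)
open import Relation.Nullary using (does)

-- Polynomials in z with integer coefficients: p = [p0, p1, ...] means Σ pj z^j
Poly : Set
Poly = List ℤ

_+P_ : Poly → Poly → Poly
[] +P q = q
(a ∷ p) +P [] = a ∷ p
(a ∷ p) +P (b ∷ q) = (a +ℤ b) ∷ (p +P q)

scaleP : ℤ → Poly → Poly
scaleP a p = map (a *ℤ_) p

_*P_ : Poly → Poly → Poly
[] *P q = []
(a ∷ p) *P q = scaleP a q +P ((+ 0) ∷ (p *P q))

shiftP : ℕ → Poly → Poly
shiftP zero p = p
shiftP (suc n) p = (+ 0) ∷ shiftP n p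

coeffP : Poly → ℕ → ℤ
coeffP [] _ = + 0
coeffP (a ∷ p) zero = a
coeffP (a ∷ p) (suc n) = coeffP p n

-- Laurent polynomials in z: laurent N p represents z^(-N) · p(z)
record Laurent : Set where
  constructor laurent
  field
    negdeg : ℕ
    poly   : Poly

zeroL : Laurent
zeroL = laurent 0 []

oneL : Laurent
oneL = laurent 0 ((+ 1) ∷ [])

constL : ℤ → Laurent
constL a = laurent 0 (a ∷ [])

zL : Laurent
zL = laurent 0 ((+ 0) ∷ (+ 1) ∷ [])

zinvL : Laurent
zinvL = laurent 1 ((+ 1) ∷ [])

addL : Laurent → Laurent → Laurent
addL (laurent N p) (laurent M q) = laurent (N +ℕ M) (shiftP M p +P shiftP N q)

mulL : Laurent → Laurent → Laurent
mulL (laurent N p) (laurent M q) = laurent (N +ℕ M) (p *P q)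

powL : Laurent → ℕ → Laurent
powL c zero = oneL
powL c (suc k) = mulL c (powL c k)

sumL : List Laurent → Laurent
sumL = foldr addL zeroL

coeffAux : Poly → ℤ → ℤ
coeffAux p (+ j) = coeffP p j
coeffAux p -[1+ _ ] = + 0

coeffL : Laurent → ℤ → ℤ
coeffL (laurent N p) m = coeffAux p (m +ℤ + N)

Series : Set
Series = ℕ → Laurent

oneS : Series
oneS zero = oneL
oneS (suc _) = zeroL

addS : Series → Series → Series
addS f g n = addL (f n) (g n)

mulS : Series → Series → Series
mulS f g n = sumL (map (λ j → mulL (f j) (g (n ∸ j))) (upTo (suc n)))

powS : Series → ℕ → Series
powS f zero = oneS
powS f (suc k) = mulS f (powS f k)

monoS : Laurent → ℕ → Series
monoS c i n = if does (n ≟ℕ i) then c else zeroL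

-- (1 - c q^i)^(-1) = Σ_k c^k q^(i k)   (used for i ≥ 1)
geomS : Laurent → ℕ → Series
geomS c i n = sumL (map (λ k → if does ((i * k) ≟ℕ n) then powL c k else zeroL) (upTo (suc n)))

epsFactor : ℤ → ℤ → ℕ → Series
epsFactor ε (+ d) i = powS (addS oneS (monoS (constL ε) i)) d
epsFactor ε -[1+ d ] i = powS (geomS (constL (- ε)) i) (suc d)

factor : (ℕ → ℕ) → (ℕ → ℕ) → (ℕ → ℤ) → ℤ → ℕ → Series
factor a b c ε i =
  mulS (mulS (powS (geomS zL i) (a i)) (powS (geomS zinvL i) (b i))) (epsFactor ε (c i) i)

prodTo : (ℕ → ℕ) → (ℕ → ℕ) → (ℕ → ℤ) → ℤ → ℕ → Series
prodTo a b c ε zero = oneS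
prodTo a b c ε (suc N) = mulS (prodTo a b c ε N) (factor a b c ε (suc N))

-- F_n(z) = [q^n] ∏_{i ≥ 1} factor i ; factors with i > n are 1 + O(q^(n+1)),
-- so the coefficient of q^n in the full product equals that of ∏_{i=1}^{n}.
F : (ℕ → ℕ) → (ℕ → ℕ) → (ℕ → ℤ) → ℤ → ℕ → Laurent
F a b c ε n = prodTo a b c ε n n

-- Since a₁ = 1, multiplying the product by 1 − z q cancels its only factor (1 − z q)⁻¹. In every
-- remaining factor a positive power z^k only comes with q^(i k) for some i ≥ 2, so the coefficient
-- of q^n in (1 − z q) ∏ has z-degree at most n / 2. Comparing coefficients of z^(m+1) q^(n+1) on both
-- sides of (1 − z q) ∏ = ∏ − z q ∏ then gives [z^(m+1)] F_(n+1) = [z^m] F_n whenever m ≥ ⌊(n+1)/2⌋,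
-- which covers m = n − k with 2k ≤ n. The negative powers are treated identically with z⁻¹ and b₁ = 1.
module Submission where

open import Defs
open import Data.Bool using (if_then_else_)
open import Data.Integer using (ℤ; +_; -[1+_]; -_; _⊖_; _-_) renaming (_+_ to _+ℤ_; _*_ to _*ℤ_)
import Data.Integer.Properties as ℤ
open import Data.Integer.Tactic.RingSolver using (solve-∀)
open import Data.List using ([]; _∷_; map; applyUpTo)
open import Data.Nat using (ℕ; zero; suc; _+_; _*_; _∸_; _≤_; _<_; z≤n; s≤s; ⌊_/2⌋; _≟_; _≤?_)
import Data.Nat.Properties as ℕ
import Data.Nat.Tactic.RingSolver as ℕ-Solver
open import Data.Product using (_×_; _,_)
open import Data.Sum using (_⊎_)
open import Function using (id; _∘_)
open import Relation.Binary.PropositionalEquality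
open import Relation.Nullary using (yes; no; does; Dec; ¬_)
open import Relation.Nullary.Decidable using (dec-true; dec-false)

open ≡-Reasoning

-- Polynomials

infix 4 _≈P_

_≈P_ : Poly → Poly → Set
p ≈P q = ∀ j → coeffP p j ≡ coeffP q j

Null : Poly → Set
Null p = ∀ j → coeffP p j ≡ + 0

coeffP-+P : ∀ p q j → coeffP (p +P q) j ≡ coeffP p j +ℤ coeffP q j
coeffP-+P []      q       j       = sym (ℤ.+-identityˡ _)
coeffP-+P (a ∷ p) []      j       = sym (ℤ.+-identityʳ _)
coeffP-+P (a ∷ p) (b ∷ q) zero    = refl
coeffP-+P (a ∷ p) (b ∷ q) (suc j) = coeffP-+P p q j

coeffP-scaleP : ∀ a p j → coeffP (scaleP a p) j ≡ a *ℤ coeffP p j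
coeffP-scaleP a []      j       = sym (ℤ.*-zeroʳ a)
coeffP-scaleP a (b ∷ p) zero    = refl
coeffP-scaleP a (b ∷ p) (suc j) = coeffP-scaleP a p j

coeffP-∷-*P-zero : ∀ a p q → coeffP ((a ∷ p) *P q) zero ≡ a *ℤ coeffP q zero
coeffP-∷-*P-zero a p q =
  trans (coeffP-+P (scaleP a q) _ zero) (trans (ℤ.+-identityʳ _) (coeffP-scaleP a q zero))

coeffP-∷-*P-suc : ∀ a p q j →
  coeffP ((a ∷ p) *P q) (suc j) ≡ a *ℤ coeffP q (suc j) +ℤ coeffP (p *P q) j
coeffP-∷-*P-suc a p q j =
  trans (coeffP-+P (scaleP a q) _ (suc j)) (cong (_+ℤ coeffP (p *P q) j) (coeffP-scaleP a q (suc j)))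

*P-nullˡ : ∀ p q → Null p → Null (p *P q)
*P-nullˡ []      q p≈0 j       = refl
*P-nullˡ (a ∷ p) q p≈0 zero    = begin
  coeffP ((a ∷ p) *P q) 0   ≡⟨ coeffP-∷-*P-zero a p q ⟩
  a *ℤ coeffP q 0           ≡⟨ cong (_*ℤ coeffP q 0) (p≈0 0) ⟩
  + 0                       ∎
*P-nullˡ (a ∷ p) q p≈0 (suc j) = begin
  coeffP ((a ∷ p) *P q) (suc j)                   ≡⟨ coeffP-∷-*P-suc a p q j ⟩
  a *ℤ coeffP q (suc j) +ℤ coeffP (p *P q) j      ≡⟨ cong₂ _+ℤ_ (cong (_*ℤ coeffP q (suc j)) (p≈0 0))
                                                                (*P-nullˡ p q (p≈0 ∘ suc) j) ⟩
  + 0                                             ∎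

*P-nullʳ : ∀ p q → Null q → Null (p *P q)
*P-nullʳ []      q q≈0 j       = refl
*P-nullʳ (a ∷ p) q q≈0 zero    = begin
  coeffP ((a ∷ p) *P q) 0   ≡⟨ coeffP-∷-*P-zero a p q ⟩
  a *ℤ coeffP q 0           ≡⟨ cong (a *ℤ_) (q≈0 0) ⟩
  a *ℤ + 0                  ≡⟨ ℤ.*-zeroʳ a ⟩
  + 0                       ∎
*P-nullʳ (a ∷ p) q q≈0 (suc j) = begin
  coeffP ((a ∷ p) *P q) (suc j)                   ≡⟨ coeffP-∷-*P-suc a p q j ⟩
  a *ℤ coeffP q (suc j) +ℤ coeffP (p *P q) j      ≡⟨ cong₂ _+ℤ_ (cong (a *ℤ_) (q≈0 (suc j))) (*P-nullʳ p q q≈0 j) ⟩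
  a *ℤ + 0 +ℤ + 0                                 ≡⟨ cong (_+ℤ + 0) (ℤ.*-zeroʳ a) ⟩
  + 0                                             ∎

*P-congˡ : ∀ p {q q′} → q ≈P q′ → p *P q ≈P p *P q′
*P-congˡ []      q≈q′ j       = refl
*P-congˡ (a ∷ p) {q} {q′} q≈q′ zero = begin
  coeffP ((a ∷ p) *P q) 0   ≡⟨ coeffP-∷-*P-zero a p q ⟩
  a *ℤ coeffP q 0           ≡⟨ cong (a *ℤ_) (q≈q′ 0) ⟩
  a *ℤ coeffP q′ 0          ≡⟨ coeffP-∷-*P-zero a p q′ ⟨
  coeffP ((a ∷ p) *P q′) 0  ∎
*P-congˡ (a ∷ p) {q} {q′} q≈q′ (suc j) = begin
  coeffP ((a ∷ p) *P q) (suc j)                ≡⟨ coeffP-∷-*P-suc a p q j ⟩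
  a *ℤ coeffP q (suc j) +ℤ coeffP (p *P q) j   ≡⟨ cong₂ _+ℤ_ (cong (a *ℤ_) (q≈q′ (suc j))) (*P-congˡ p q≈q′ j) ⟩
  a *ℤ coeffP q′ (suc j) +ℤ coeffP (p *P q′) j ≡⟨ coeffP-∷-*P-suc a p q′ j ⟨
  coeffP ((a ∷ p) *P q′) (suc j)               ∎

*P-distribʳ-+P : ∀ p q r → (p +P q) *P r ≈P (p *P r) +P (q *P r)
*P-distribʳ-+P []      q       r j = refl
*P-distribʳ-+P (a ∷ p) []      r j = sym (trans (coeffP-+P ((a ∷ p) *P r) [] j) (ℤ.+-identityʳ _))
*P-distribʳ-+P (a ∷ p) (b ∷ q) r zero = begin
  coeffP ((a +ℤ b ∷ p +P q) *P r) 0                   ≡⟨ coeffP-∷-*P-zero (a +ℤ b) (p +P q) r ⟩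
  (a +ℤ b) *ℤ coeffP r 0                              ≡⟨ ℤ.*-distribʳ-+ (coeffP r 0) a b ⟩
  a *ℤ coeffP r 0 +ℤ b *ℤ coeffP r 0                  ≡⟨ cong₂ _+ℤ_ (coeffP-∷-*P-zero a p r) (coeffP-∷-*P-zero b q r) ⟨
  coeffP ((a ∷ p) *P r) 0 +ℤ coeffP ((b ∷ q) *P r) 0  ≡⟨ coeffP-+P ((a ∷ p) *P r) ((b ∷ q) *P r) 0 ⟨
  coeffP (((a ∷ p) *P r) +P ((b ∷ q) *P r)) 0         ∎
*P-distribʳ-+P (a ∷ p) (b ∷ q) r (suc j) = begin
  coeffP ((a +ℤ b ∷ p +P q) *P r) (suc j)
    ≡⟨ coeffP-∷-*P-suc (a +ℤ b) (p +P q) r j ⟩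
  (a +ℤ b) *ℤ r₁ +ℤ coeffP ((p +P q) *P r) j
    ≡⟨ cong ((a +ℤ b) *ℤ r₁ +ℤ_) (trans (*P-distribʳ-+P p q r j) (coeffP-+P (p *P r) (q *P r) j)) ⟩
  (a +ℤ b) *ℤ r₁ +ℤ (coeffP (p *P r) j +ℤ coeffP (q *P r) j)
    ≡⟨ regroup a b r₁ (coeffP (p *P r) j) (coeffP (q *P r) j) ⟩
  (a *ℤ r₁ +ℤ coeffP (p *P r) j) +ℤ (b *ℤ r₁ +ℤ coeffP (q *P r) j)
    ≡⟨ cong₂ _+ℤ_ (coeffP-∷-*P-suc a p r j) (coeffP-∷-*P-suc b q r j) ⟨
  coeffP ((a ∷ p) *P r) (suc j) +ℤ coeffP ((b ∷ q) *P r) (suc j)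
    ≡⟨ coeffP-+P ((a ∷ p) *P r) ((b ∷ q) *P r) (suc j) ⟨
  coeffP (((a ∷ p) *P r) +P ((b ∷ q) *P r)) (suc j) ∎
  where
  r₁ = coeffP r (suc j)
  regroup : ∀ a b c u v → (a +ℤ b) *ℤ c +ℤ (u +ℤ v) ≡ (a *ℤ c +ℤ u) +ℤ (b *ℤ c +ℤ v)
  regroup = solve-∀

*P-distribˡ-+P : ∀ p q r → p *P (q +P r) ≈P (p *P q) +P (p *P r)
*P-distribˡ-+P []      q r j = refl
*P-distribˡ-+P (a ∷ p) q r zero = begin
  coeffP ((a ∷ p) *P (q +P r)) 0                      ≡⟨ coeffP-∷-*P-zero a p (q +P r) ⟩
  a *ℤ coeffP (q +P r) 0                              ≡⟨ cong (a *ℤ_) (coeffP-+P q r 0) ⟩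
  a *ℤ (coeffP q 0 +ℤ coeffP r 0)                     ≡⟨ ℤ.*-distribˡ-+ a (coeffP q 0) (coeffP r 0) ⟩
  a *ℤ coeffP q 0 +ℤ a *ℤ coeffP r 0                  ≡⟨ cong₂ _+ℤ_ (coeffP-∷-*P-zero a p q) (coeffP-∷-*P-zero a p r) ⟨
  coeffP ((a ∷ p) *P q) 0 +ℤ coeffP ((a ∷ p) *P r) 0  ≡⟨ coeffP-+P ((a ∷ p) *P q) ((a ∷ p) *P r) 0 ⟨
  coeffP (((a ∷ p) *P q) +P ((a ∷ p) *P r)) 0         ∎
*P-distribˡ-+P (a ∷ p) q r (suc j) = begin
  coeffP ((a ∷ p) *P (q +P r)) (suc j)
    ≡⟨ coeffP-∷-*P-suc a p (q +P r) j ⟩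
  a *ℤ coeffP (q +P r) (suc j) +ℤ coeffP (p *P (q +P r)) j
    ≡⟨ cong₂ _+ℤ_ (cong (a *ℤ_) (coeffP-+P q r (suc j)))
                  (trans (*P-distribˡ-+P p q r j) (coeffP-+P (p *P q) (p *P r) j)) ⟩
  a *ℤ (q₁ +ℤ r₁) +ℤ (coeffP (p *P q) j +ℤ coeffP (p *P r) j)
    ≡⟨ regroup a q₁ r₁ (coeffP (p *P q) j) (coeffP (p *P r) j) ⟩
  (a *ℤ q₁ +ℤ coeffP (p *P q) j) +ℤ (a *ℤ r₁ +ℤ coeffP (p *P r) j)
    ≡⟨ cong₂ _+ℤ_ (coeffP-∷-*P-suc a p q j) (coeffP-∷-*P-suc a p r j) ⟨
  coeffP ((a ∷ p) *P q) (suc j) +ℤ coeffP ((a ∷ p) *P r) (suc j)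
    ≡⟨ coeffP-+P ((a ∷ p) *P q) ((a ∷ p) *P r) (suc j) ⟨
  coeffP (((a ∷ p) *P q) +P ((a ∷ p) *P r)) (suc j) ∎
  where
  q₁ = coeffP q (suc j)
  r₁ = coeffP r (suc j)
  regroup : ∀ a b c u v → a *ℤ (b +ℤ c) +ℤ (u +ℤ v) ≡ (a *ℤ b +ℤ u) +ℤ (a *ℤ c +ℤ v)
  regroup = solve-∀

scaleP-*P : ∀ a p q → scaleP a p *P q ≈P scaleP a (p *P q)
scaleP-*P a []      q j = refl
scaleP-*P a (b ∷ p) q zero = begin
  coeffP ((a *ℤ b ∷ scaleP a p) *P q) 0  ≡⟨ coeffP-∷-*P-zero (a *ℤ b) (scaleP a p) q ⟩
  a *ℤ b *ℤ coeffP q 0                   ≡⟨ ℤ.*-assoc a b _ ⟩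
  a *ℤ (b *ℤ coeffP q 0)                 ≡⟨ cong (a *ℤ_) (coeffP-∷-*P-zero b p q) ⟨
  a *ℤ coeffP ((b ∷ p) *P q) 0           ≡⟨ coeffP-scaleP a ((b ∷ p) *P q) 0 ⟨
  coeffP (scaleP a ((b ∷ p) *P q)) 0     ∎
scaleP-*P a (b ∷ p) q (suc j) = begin
  coeffP ((a *ℤ b ∷ scaleP a p) *P q) (suc j)
    ≡⟨ coeffP-∷-*P-suc (a *ℤ b) (scaleP a p) q j ⟩
  a *ℤ b *ℤ q₁ +ℤ coeffP (scaleP a p *P q) j
    ≡⟨ cong (a *ℤ b *ℤ q₁ +ℤ_) (trans (scaleP-*P a p q j) (coeffP-scaleP a (p *P q) j)) ⟩
  a *ℤ b *ℤ q₁ +ℤ a *ℤ coeffP (p *P q) j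
    ≡⟨ factor-out a b q₁ (coeffP (p *P q) j) ⟩
  a *ℤ (b *ℤ q₁ +ℤ coeffP (p *P q) j)
    ≡⟨ cong (a *ℤ_) (coeffP-∷-*P-suc b p q j) ⟨
  a *ℤ coeffP ((b ∷ p) *P q) (suc j)
    ≡⟨ coeffP-scaleP a ((b ∷ p) *P q) (suc j) ⟨
  coeffP (scaleP a ((b ∷ p) *P q)) (suc j) ∎
  where
  q₁ = coeffP q (suc j)
  factor-out : ∀ a b c u → a *ℤ b *ℤ c +ℤ a *ℤ u ≡ a *ℤ (b *ℤ c +ℤ u)
  factor-out = solve-∀

*P-scaleP : ∀ a p q → p *P scaleP a q ≈P scaleP a (p *P q)
*P-scaleP a []      q j = refl
*P-scaleP a (b ∷ p) q zero = begin
  coeffP ((b ∷ p) *P scaleP a q) 0   ≡⟨ coeffP-∷-*P-zero b p (scaleP a q) ⟩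
  b *ℤ coeffP (scaleP a q) 0         ≡⟨ cong (b *ℤ_) (coeffP-scaleP a q 0) ⟩
  b *ℤ (a *ℤ coeffP q 0)             ≡⟨ left-commute b a _ ⟩
  a *ℤ (b *ℤ coeffP q 0)             ≡⟨ cong (a *ℤ_) (coeffP-∷-*P-zero b p q) ⟨
  a *ℤ coeffP ((b ∷ p) *P q) 0       ≡⟨ coeffP-scaleP a ((b ∷ p) *P q) 0 ⟨
  coeffP (scaleP a ((b ∷ p) *P q)) 0 ∎
  where
  left-commute : ∀ x y z → x *ℤ (y *ℤ z) ≡ y *ℤ (x *ℤ z)
  left-commute = solve-∀
*P-scaleP a (b ∷ p) q (suc j) = begin
  coeffP ((b ∷ p) *P scaleP a q) (suc j)
    ≡⟨ coeffP-∷-*P-suc b p (scaleP a q) j ⟩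
  b *ℤ coeffP (scaleP a q) (suc j) +ℤ coeffP (p *P scaleP a q) j
    ≡⟨ cong₂ _+ℤ_ (cong (b *ℤ_) (coeffP-scaleP a q (suc j)))
                  (trans (*P-scaleP a p q j) (coeffP-scaleP a (p *P q) j)) ⟩
  b *ℤ (a *ℤ q₁) +ℤ a *ℤ coeffP (p *P q) j
    ≡⟨ factor-out a b q₁ (coeffP (p *P q) j) ⟩
  a *ℤ (b *ℤ q₁ +ℤ coeffP (p *P q) j)
    ≡⟨ cong (a *ℤ_) (coeffP-∷-*P-suc b p q j) ⟨
  a *ℤ coeffP ((b ∷ p) *P q) (suc j)
    ≡⟨ coeffP-scaleP a ((b ∷ p) *P q) (suc j) ⟨
  coeffP (scaleP a ((b ∷ p) *P q)) (suc j) ∎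
  where
  q₁ = coeffP q (suc j)
  factor-out : ∀ a b c u → b *ℤ (a *ℤ c) +ℤ a *ℤ u ≡ a *ℤ (b *ℤ c +ℤ u)
  factor-out = solve-∀

shiftP-*P : ∀ k p q → shiftP k p *P q ≈P shiftP k (p *P q)
shiftP-*P zero    p q j       = refl
shiftP-*P (suc k) p q zero    = coeffP-∷-*P-zero (+ 0) (shiftP k p) q
shiftP-*P (suc k) p q (suc j) =
  trans (coeffP-∷-*P-suc (+ 0) (shiftP k p) q j)
        (trans (ℤ.+-identityˡ _) (shiftP-*P k p q j))

*P-∷0 : ∀ p q → p *P (+ 0 ∷ q) ≈P + 0 ∷ (p *P q)
*P-∷0 []      q zero    = refl
*P-∷0 []      q (suc j) = refl
*P-∷0 (a ∷ p) q zero    = trans (coeffP-∷-*P-zero a p (+ 0 ∷ q)) (ℤ.*-zeroʳ a)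
*P-∷0 (a ∷ p) q (suc zero) = begin
  coeffP ((a ∷ p) *P (+ 0 ∷ q)) 1                 ≡⟨ coeffP-∷-*P-suc a p (+ 0 ∷ q) 0 ⟩
  a *ℤ coeffP q 0 +ℤ coeffP (p *P (+ 0 ∷ q)) 0    ≡⟨ cong (a *ℤ coeffP q 0 +ℤ_) (*P-∷0 p q 0) ⟩
  a *ℤ coeffP q 0 +ℤ + 0                          ≡⟨ ℤ.+-identityʳ _ ⟩
  a *ℤ coeffP q 0                                 ≡⟨ coeffP-∷-*P-zero a p q ⟨
  coeffP ((a ∷ p) *P q) 0                         ∎
*P-∷0 (a ∷ p) q (suc (suc j)) = begin
  coeffP ((a ∷ p) *P (+ 0 ∷ q)) (suc (suc j))                 ≡⟨ coeffP-∷-*P-suc a p (+ 0 ∷ q) (suc j) ⟩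
  a *ℤ coeffP q (suc j) +ℤ coeffP (p *P (+ 0 ∷ q)) (suc j)    ≡⟨ cong (a *ℤ coeffP q (suc j) +ℤ_) (*P-∷0 p q (suc j)) ⟩
  a *ℤ coeffP q (suc j) +ℤ coeffP (p *P q) j                  ≡⟨ coeffP-∷-*P-suc a p q j ⟨
  coeffP ((a ∷ p) *P q) (suc j)                               ∎

∷-cong : ∀ a {p q} → p ≈P q → a ∷ p ≈P a ∷ q
∷-cong a p≈q zero    = refl
∷-cong a p≈q (suc j) = p≈q j

*P-shiftP : ∀ k p q → p *P shiftP k q ≈P shiftP k (p *P q)
*P-shiftP zero    p q j       = refl
*P-shiftP (suc k) p q zero    = *P-∷0 p (shiftP k q) zero
*P-shiftP (suc k) p q (suc j) = trans (*P-∷0 p (shiftP k q) (suc j)) (*P-shiftP k p q j)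

*P-identityˡ : ∀ q → (+ 1 ∷ []) *P q ≈P q
*P-identityˡ q zero    = trans (coeffP-∷-*P-zero (+ 1) [] q) (ℤ.*-identityˡ _)
*P-identityˡ q (suc j) =
  trans (coeffP-∷-*P-suc (+ 1) [] q j) (trans (ℤ.+-identityʳ _) (ℤ.*-identityˡ _))

*P-identityʳ : ∀ p → p *P (+ 1 ∷ []) ≈P p
*P-identityʳ []      j       = refl
*P-identityʳ (a ∷ p) zero    = trans (coeffP-∷-*P-zero a p (+ 1 ∷ [])) (ℤ.*-identityʳ a)
*P-identityʳ (a ∷ p) (suc j) = begin
  coeffP ((a ∷ p) *P (+ 1 ∷ [])) (suc j)       ≡⟨ coeffP-∷-*P-suc a p (+ 1 ∷ []) j ⟩
  a *ℤ + 0 +ℤ coeffP (p *P (+ 1 ∷ [])) j      ≡⟨ cong (_+ℤ coeffP (p *P (+ 1 ∷ [])) j) (ℤ.*-zeroʳ a) ⟩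
  + 0 +ℤ coeffP (p *P (+ 1 ∷ [])) j           ≡⟨ ℤ.+-identityˡ _ ⟩
  coeffP (p *P (+ 1 ∷ [])) j                  ≡⟨ *P-identityʳ p j ⟩
  coeffP p j                                  ∎

coeffP-shiftP-< : ∀ k p j → j < k → coeffP (shiftP k p) j ≡ + 0
coeffP-shiftP-< (suc k) p zero    j<k       = refl
coeffP-shiftP-< (suc k) p (suc j) (s≤s j<k) = coeffP-shiftP-< k p j j<k

coeffP-shiftP-+ : ∀ k p j → coeffP (shiftP k p) (k + j) ≡ coeffP p j
coeffP-shiftP-+ zero    p j = refl
coeffP-shiftP-+ (suc k) p j = coeffP-shiftP-+ k p j

coeffAux-cong : ∀ {p q} → p ≈P q → ∀ x → coeffAux p x ≡ coeffAux q x
coeffAux-cong p≈q (+ j)     = p≈q j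
coeffAux-cong p≈q -[1+ j ] = refl

coeffAux-[] : ∀ x → coeffAux [] x ≡ + 0
coeffAux-[] (+ j)     = refl
coeffAux-[] -[1+ j ] = refl

coeffAux-null : ∀ {p} → Null p → ∀ x → coeffAux p x ≡ + 0
coeffAux-null p≈0 (+ j)     = p≈0 j
coeffAux-null p≈0 -[1+ j ] = refl

coeffAux-+P : ∀ p q x → coeffAux (p +P q) x ≡ coeffAux p x +ℤ coeffAux q x
coeffAux-+P p q (+ j)     = coeffP-+P p q j
coeffAux-+P p q -[1+ j ] = refl

coeffAux-scaleP : ∀ a p x → coeffAux (scaleP a p) x ≡ a *ℤ coeffAux p x
coeffAux-scaleP a p (+ j)     = coeffP-scaleP a p j
coeffAux-scaleP a p -[1+ j ] = sym (ℤ.*-zeroʳ a)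

coeffAux-shiftP : ∀ k q x → coeffAux (shiftP k q) (x +ℤ + k) ≡ coeffAux q x
coeffAux-shiftP k q (+ j) = trans (cong (coeffP (shiftP k q)) (ℕ.+-comm j k)) (coeffP-shiftP-+ k q j)
coeffAux-shiftP k q -[1+ j ] with suc j ≤? k
... | yes j<k rewrite ℤ.⊖-≥ j<k = coeffP-shiftP-< k q (k ∸ suc j) (ℕ.∸-monoʳ-< (s≤s z≤n) j<k)
... | no  j≮k rewrite ℤ.⊖-< (ℕ.≰⇒> j≮k) | ℕ.+-∸-assoc 1 (ℕ.≤-pred (ℕ.≰⇒> j≮k)) = refl

-- Laurent polynomials

infix 4 _≈L_

_≈L_ : Laurent → Laurent → Set
A ≈L B = ∀ m → coeffL A m ≡ coeffL B m

-- The same Laurent polynomial, represented with k more negative powers of z.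
raiseL : ℕ → Laurent → Laurent
raiseL k (laurent N p) = laurent (N + k) (shiftP k p)

laurent-cong : ∀ N {p q} → p ≈P q → laurent N p ≈L laurent N q
laurent-cong N p≈q m = coeffAux-cong p≈q (m +ℤ + N)

laurent-negdeg-cong : ∀ {N N′} p → N ≡ N′ → laurent N p ≈L laurent N′ p
laurent-negdeg-cong p refl m = refl

≈L⇒≈P : ∀ N {p q} → laurent N p ≈L laurent N q → p ≈P q
≈L⇒≈P N {p} {q} p≈q j = subst (λ x → coeffAux p x ≡ coeffAux q x) (cancel (+ j) (+ N)) (p≈q (+ j - + N))
  where
  cancel : ∀ x y → x - y +ℤ y ≡ x
  cancel = solve-∀

raiseL-≈L : ∀ k A → raiseL k A ≈L A
raiseL-≈L k (laurent N p) m = begin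
  coeffAux (shiftP k p) (m +ℤ + (N + k))    ≡⟨ cong (coeffAux (shiftP k p)) (+-pos-+ m N k) ⟩
  coeffAux (shiftP k p) (m +ℤ + N +ℤ + k)   ≡⟨ coeffAux-shiftP k p (m +ℤ + N) ⟩
  coeffAux p (m +ℤ + N)                     ∎
  where
  +-pos-+ : ∀ m N k → m +ℤ + (N + k) ≡ m +ℤ + N +ℤ + k
  +-pos-+ m N k = trans (cong (m +ℤ_) (ℤ.pos-+ N k)) (sym (ℤ.+-assoc m (+ N) (+ k)))

coeffL-zeroL : ∀ m → coeffL zeroL m ≡ + 0
coeffL-zeroL m = coeffAux-[] (m +ℤ + 0)

coeffL-laurent-+P : ∀ N p q m → coeffL (laurent N (p +P q)) m ≡ coeffL (laurent N p) m +ℤ coeffL (laurent N q) m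
coeffL-laurent-+P N p q m = coeffAux-+P p q (m +ℤ + N)

coeffL-addL : ∀ A B m → coeffL (addL A B) m ≡ coeffL A m +ℤ coeffL B m
coeffL-addL A@(laurent N p) B@(laurent M q) m =
  trans (coeffL-laurent-+P (N + M) (shiftP M p) (shiftP N q) m)
        (cong₂ _+ℤ_ (raiseL-≈L M A m)
                    (trans (laurent-negdeg-cong (shiftP N q) (ℕ.+-comm N M) m) (raiseL-≈L N B m)))

mulL-raiseLˡ : ∀ k A B → mulL (raiseL k A) B ≈L mulL A B
mulL-raiseLˡ k (laurent N p) (laurent M r) m = begin
  coeffL (laurent (N + k + M) (shiftP k p *P r)) m    ≡⟨ laurent-cong (N + k + M) (shiftP-*P k p r) m ⟩
  coeffL (laurent (N + k + M) (shiftP k (p *P r))) m  ≡⟨ laurent-negdeg-cong (shiftP k (p *P r)) (right-comm N k M) m ⟩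
  coeffL (raiseL k (laurent (N + M) (p *P r))) m      ≡⟨ raiseL-≈L k (laurent (N + M) (p *P r)) m ⟩
  coeffL (laurent (N + M) (p *P r)) m                 ∎
  where
  right-comm : ∀ a b c → a + b + c ≡ a + c + b
  right-comm = ℕ-Solver.solve-∀

mulL-raiseLʳ : ∀ k A B → mulL A (raiseL k B) ≈L mulL A B
mulL-raiseLʳ k (laurent N p) (laurent M r) m = begin
  coeffL (laurent (N + (M + k)) (p *P shiftP k r)) m   ≡⟨ laurent-cong (N + (M + k)) (*P-shiftP k p r) m ⟩
  coeffL (laurent (N + (M + k)) (shiftP k (p *P r))) m ≡⟨ laurent-negdeg-cong (shiftP k (p *P r)) (sym (ℕ.+-assoc N M k)) m ⟩
  coeffL (raiseL k (laurent (N + M) (p *P r))) m       ≡⟨ raiseL-≈L k (laurent (N + M) (p *P r)) m ⟩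
  coeffL (laurent (N + M) (p *P r)) m                  ∎

-- Raised to the common negdeg N + N′, B and B′ have coefficientwise equal polynomial parts.
mulL-congˡ : ∀ A {B B′} → B ≈L B′ → mulL A B ≈L mulL A B′
mulL-congˡ A@(laurent NA p) {B@(laurent N q)} {B′@(laurent N′ q′)} B≈B′ m = begin
  coeffL (mulL A B) m                                  ≡⟨ mulL-raiseLʳ N′ A B m ⟨
  coeffL (mulL A (laurent (N + N′) (shiftP N′ q))) m   ≡⟨ laurent-cong (NA + (N + N′)) (*P-congˡ p raised≈) m ⟩
  coeffL (mulL A (laurent (N + N′) (shiftP N q′))) m
    ≡⟨ laurent-negdeg-cong (p *P shiftP N q′) (cong (λ K → NA + K) (ℕ.+-comm N N′)) m ⟩
  coeffL (mulL A (raiseL N B′)) m                      ≡⟨ mulL-raiseLʳ N A B′ m ⟩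
  coeffL (mulL A B′) m                                 ∎
  where
  raised≈ : shiftP N′ q ≈P shiftP N q′
  raised≈ = ≈L⇒≈P (N + N′) λ x → begin
    coeffL (raiseL N′ B) x                         ≡⟨ raiseL-≈L N′ B x ⟩
    coeffL B x                                     ≡⟨ B≈B′ x ⟩
    coeffL B′ x                                    ≡⟨ raiseL-≈L N B′ x ⟨
    coeffL (raiseL N B′) x                         ≡⟨ laurent-negdeg-cong (shiftP N q′) (ℕ.+-comm N′ N) x ⟩
    coeffL (laurent (N + N′) (shiftP N q′)) x      ∎

mulL-distribʳ-addL : ∀ A B Y m → coeffL (mulL (addL A B) Y) m ≡ coeffL (mulL A Y) m +ℤ coeffL (mulL B Y) m
mulL-distribʳ-addL A@(laurent N p) B@(laurent M q) Y@(laurent K r) m = begin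
  coeffL (laurent (N + M + K) ((shiftP M p +P shiftP N q) *P r)) m
    ≡⟨ laurent-cong (N + M + K) (*P-distribʳ-+P (shiftP M p) (shiftP N q) r) m ⟩
  coeffL (laurent (N + M + K) ((shiftP M p *P r) +P (shiftP N q *P r))) m
    ≡⟨ coeffL-laurent-+P (N + M + K) (shiftP M p *P r) (shiftP N q *P r) m ⟩
  coeffL (mulL (raiseL M A) Y) m +ℤ coeffL (laurent (N + M + K) (shiftP N q *P r)) m
    ≡⟨ cong (coeffL (mulL (raiseL M A) Y) m +ℤ_)
            (laurent-negdeg-cong (shiftP N q *P r) (cong (_+ K) (ℕ.+-comm N M)) m) ⟩
  coeffL (mulL (raiseL M A) Y) m +ℤ coeffL (mulL (raiseL N B) Y) m
    ≡⟨ cong₂ _+ℤ_ (mulL-raiseLˡ M A Y m) (mulL-raiseLˡ N B Y m) ⟩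
  coeffL (mulL A Y) m +ℤ coeffL (mulL B Y) m ∎

mulL-distribˡ-addL : ∀ A B C m → coeffL (mulL A (addL B C)) m ≡ coeffL (mulL A B) m +ℤ coeffL (mulL A C) m
mulL-distribˡ-addL A@(laurent N p) B@(laurent M q) C@(laurent K r) m = begin
  coeffL (laurent (N + (M + K)) (p *P (shiftP K q +P shiftP M r))) m
    ≡⟨ laurent-cong (N + (M + K)) (*P-distribˡ-+P p (shiftP K q) (shiftP M r)) m ⟩
  coeffL (laurent (N + (M + K)) ((p *P shiftP K q) +P (p *P shiftP M r))) m
    ≡⟨ coeffL-laurent-+P (N + (M + K)) (p *P shiftP K q) (p *P shiftP M r) m ⟩
  coeffL (mulL A (raiseL K B)) m +ℤ coeffL (laurent (N + (M + K)) (p *P shiftP M r)) m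
    ≡⟨ cong (coeffL (mulL A (raiseL K B)) m +ℤ_)
            (laurent-negdeg-cong (p *P shiftP M r) (cong (λ L → N + L) (ℕ.+-comm M K)) m) ⟩
  coeffL (mulL A (raiseL K B)) m +ℤ coeffL (mulL A (raiseL M C)) m
    ≡⟨ cong₂ _+ℤ_ (mulL-raiseLʳ K A B m) (mulL-raiseLʳ M A C m) ⟩
  coeffL (mulL A B) m +ℤ coeffL (mulL A C) m ∎

mulL-zeroʳ : ∀ A m → coeffL (mulL A zeroL) m ≡ + 0
mulL-zeroʳ (laurent N p) m = coeffAux-null (*P-nullʳ p [] (λ _ → refl)) (m +ℤ + (N + 0))

mulL-identityʳ : ∀ A → mulL A oneL ≈L A
mulL-identityʳ (laurent N p) m =
  trans (laurent-cong (N + 0) (*P-identityʳ p) m) (laurent-negdeg-cong p (ℕ.+-identityʳ N) m)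

-- −z·B and −z⁻¹·B, represented so that only the polynomial part of B changes.
negZ : Laurent → Laurent
negZ (laurent N p) = laurent N (+ 0 ∷ scaleP -[1+ 0 ] p)

negZ⁻¹ : Laurent → Laurent
negZ⁻¹ (laurent N p) = laurent (suc N) (scaleP -[1+ 0 ] p)

negZ-mulL : ∀ B Y → mulL (negZ B) Y ≈L negZ (mulL B Y)
negZ-mulL (laurent N p) (laurent K r) = laurent-cong (N + K) λ j →
  trans (shiftP-*P 1 (scaleP -[1+ 0 ] p) r j) (∷-cong (+ 0) (scaleP-*P -[1+ 0 ] p r) j)

mulL-negZ : ∀ B Y → mulL B (negZ Y) ≈L negZ (mulL B Y)
mulL-negZ (laurent N p) (laurent K r) = laurent-cong (N + K) λ j →
  trans (*P-shiftP 1 p (scaleP -[1+ 0 ] r) j) (∷-cong (+ 0) (*P-scaleP -[1+ 0 ] p r) j)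

negZ⁻¹-mulL : ∀ B Y → mulL (negZ⁻¹ B) Y ≈L negZ⁻¹ (mulL B Y)
negZ⁻¹-mulL (laurent N p) (laurent K r) = laurent-cong (suc N + K) (scaleP-*P -[1+ 0 ] p r)

mulL-negZ⁻¹ : ∀ B Y → mulL B (negZ⁻¹ Y) ≈L negZ⁻¹ (mulL B Y)
mulL-negZ⁻¹ (laurent N p) (laurent K r) m =
  trans (laurent-cong (N + suc K) (*P-scaleP -[1+ 0 ] p r) m)
        (laurent-negdeg-cong (scaleP -[1+ 0 ] (p *P r)) (ℕ.+-suc N K) m)

coeffL-negZ : ∀ B t → coeffL (negZ B) (+ suc t) ≡ - coeffL B (+ t)
coeffL-negZ (laurent N p) t = trans (coeffP-scaleP -[1+ 0 ] p (t + N)) (ℤ.-1*i≡-i _)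

-[1+t]+[1+N]≡-t+N : ∀ t N → -[1+ t ] +ℤ + suc N ≡ - (+ t) +ℤ + N
-[1+t]+[1+N]≡-t+N zero    N = trans (ℤ.[1+m]⊖[1+n]≡m⊖n N zero) (ℤ.⊖-≥ z≤n)
-[1+t]+[1+N]≡-t+N (suc t) N = ℤ.[1+m]⊖[1+n]≡m⊖n N (suc t)

coeffL-negZ⁻¹ : ∀ B t → coeffL (negZ⁻¹ B) -[1+ t ] ≡ - coeffL B (- (+ t))
coeffL-negZ⁻¹ (laurent N p) t = begin
  coeffAux (scaleP -[1+ 0 ] p) (-[1+ t ] +ℤ + suc N)  ≡⟨ coeffAux-scaleP -[1+ 0 ] p (-[1+ t ] +ℤ + suc N) ⟩
  -[1+ 0 ] *ℤ coeffAux p (-[1+ t ] +ℤ + suc N)        ≡⟨ ℤ.-1*i≡-i _ ⟩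
  - coeffAux p (-[1+ t ] +ℤ + suc N)                  ≡⟨ cong (λ x → - coeffAux p x) (-[1+t]+[1+N]≡-t+N t N) ⟩
  - coeffAux p (- (+ t) +ℤ + N)                       ∎

coeffL-zL-mulL : ∀ B t → coeffL (mulL zL B) (+ suc t) ≡ coeffL B (+ t)
coeffL-zL-mulL (laurent N p) t = begin
  coeffP ((+ 0 ∷ + 1 ∷ []) *P p) (suc t + N)              ≡⟨ coeffP-∷-*P-suc (+ 0) (+ 1 ∷ []) p (t + N) ⟩
  + 0 +ℤ coeffP ((+ 1 ∷ []) *P p) (t + N)                 ≡⟨ ℤ.+-identityˡ _ ⟩
  coeffP ((+ 1 ∷ []) *P p) (t + N)                        ≡⟨ *P-identityˡ p (t + N) ⟩
  coeffP p (t + N)                                        ∎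

coeffL-zinvL-mulL : ∀ B t → coeffL (mulL zinvL B) -[1+ t ] ≡ coeffL B (- (+ t))
coeffL-zinvL-mulL (laurent N p) t =
  trans (coeffAux-cong (*P-identityˡ p) (-[1+ t ] +ℤ + suc N)) (cong (coeffAux p) (-[1+t]+[1+N]≡-t+N t N))

-- Sums and products of series

sumZ : (ℕ → ℤ) → ℕ → ℤ
sumZ f zero    = + 0
sumZ f (suc k) = f 0 +ℤ sumZ (f ∘ suc) k

sumZ-cong : ∀ {f g} k → (∀ j → j < k → f j ≡ g j) → sumZ f k ≡ sumZ g k
sumZ-cong zero    f≡g = refl
sumZ-cong (suc k) f≡g = cong₂ _+ℤ_ (f≡g 0 (s≤s z≤n)) (sumZ-cong k λ j j<k → f≡g (suc j) (s≤s j<k))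

sumZ-zero : ∀ {f} k → (∀ j → j < k → f j ≡ + 0) → sumZ f k ≡ + 0
sumZ-zero zero    f≡0 = refl
sumZ-zero (suc k) f≡0 = cong₂ _+ℤ_ (f≡0 0 (s≤s z≤n)) (sumZ-zero k λ j j<k → f≡0 (suc j) (s≤s j<k))

sumZ-- : ∀ f g k → sumZ (λ j → f j - g j) k ≡ sumZ f k - sumZ g k
sumZ-- f g zero    = refl
sumZ-- f g (suc k) = begin
  f 0 - g 0 +ℤ sumZ (λ j → f (suc j) - g (suc j)) k  ≡⟨ cong (f 0 - g 0 +ℤ_) (sumZ-- (f ∘ suc) (g ∘ suc) k) ⟩
  f 0 - g 0 +ℤ (sumZ (f ∘ suc) k - sumZ (g ∘ suc) k)  ≡⟨ regroup (f 0) (g 0) _ _ ⟩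
  f 0 +ℤ sumZ (f ∘ suc) k - (g 0 +ℤ sumZ (g ∘ suc) k) ∎
  where
  regroup : ∀ a b c d → a - b +ℤ (c - d) ≡ a +ℤ c - (b +ℤ d)
  regroup = solve-∀

sumZ-last : ∀ f k → sumZ f (suc k) ≡ sumZ f k +ℤ f k
sumZ-last f zero    = trans (ℤ.+-identityʳ (f 0)) (sym (ℤ.+-identityˡ (f 0)))
sumZ-last f (suc k) = trans (cong (f 0 +ℤ_) (sumZ-last (f ∘ suc) k)) (sym (ℤ.+-assoc (f 0) _ _))

coeffL-sumL : ∀ (h : ℕ → Laurent) g k m →
  coeffL (sumL (map h (applyUpTo g k))) m ≡ sumZ (λ j → coeffL (h (g j)) m) k
coeffL-sumL h g zero    m = coeffL-zeroL m
coeffL-sumL h g (suc k) m =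
  trans (coeffL-addL (h (g 0)) _ m) (cong (coeffL (h (g 0)) m +ℤ_) (coeffL-sumL h (g ∘ suc) k m))

coeffL-mulS : ∀ X Y n m → coeffL (mulS X Y n) m ≡ sumZ (λ j → coeffL (mulL (X j) (Y (n ∸ j))) m) (suc n)
coeffL-mulS X Y n = coeffL-sumL (λ j → mulL (X j) (Y (n ∸ j))) id (suc n)

mulS-congˡ-upTo : ∀ X {Y Y′} n → (∀ j → j ≤ n → Y j ≈L Y′ j) → mulS X Y n ≈L mulS X Y′ n
mulS-congˡ-upTo X {Y} {Y′} n Y≈Y′ m = begin
  coeffL (mulS X Y n) m                                   ≡⟨ coeffL-mulS X Y n m ⟩
  sumZ (λ j → coeffL (mulL (X j) (Y (n ∸ j))) m) (suc n)
    ≡⟨ sumZ-cong (suc n) (λ j _ → mulL-congˡ (X j) (Y≈Y′ (n ∸ j) (ℕ.m∸n≤m n j)) m) ⟩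
  sumZ (λ j → coeffL (mulL (X j) (Y′ (n ∸ j))) m) (suc n) ≡⟨ coeffL-mulS X Y′ n m ⟨
  coeffL (mulS X Y′ n) m                                  ∎

mulS-identityʳ : ∀ X n → mulS X oneS n ≈L X n
mulS-identityʳ X n m = trans (coeffL-mulS X oneS n m) (sum-collapses X n)
  where
  sum-collapses : ∀ X n → sumZ (λ j → coeffL (mulL (X j) (oneS (n ∸ j))) m) (suc n) ≡ coeffL (X n) m
  sum-collapses X zero    = trans (ℤ.+-identityʳ _) (mulL-identityʳ (X 0) m)
  sum-collapses X (suc n) =
    trans (cong₂ _+ℤ_ (mulL-zeroʳ (X 0) m) (sum-collapses (X ∘ suc) n)) (ℤ.+-identityˡ _)

-- Degree bounds

-- With ι = above, `Bounded ι u A` says that A has z-degree at most u; with ι = below, that A has no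
-- power of z below z^(-u).
Bounded : (ℕ → ℤ) → ℕ → Laurent → Set
Bounded ι u A = ∀ t → u ≤ t → coeffL A (ι t) ≡ + 0

above below : ℕ → ℤ
above t = + suc t
below t = -[1+ t ]

VanishesFrom : ℕ → Poly → Set
VanishesFrom d p = ∀ j → d ≤ j → coeffP p j ≡ + 0

*P-vanishesFrom : ∀ d₁ d₂ p q → VanishesFrom d₁ p → VanishesFrom (suc d₂) q → VanishesFrom (d₁ + d₂) (p *P q)
*P-vanishesFrom d₁       d₂ []      q p₀ q₀ j       d≤j       = refl
*P-vanishesFrom zero     d₂ (a ∷ p) q p₀ q₀ j       d≤j       = *P-nullˡ (a ∷ p) q (λ i → p₀ i z≤n) j
*P-vanishesFrom (suc d₁) d₂ (a ∷ p) q p₀ q₀ (suc j) (s≤s d≤j) = begin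
  coeffP ((a ∷ p) *P q) (suc j)                ≡⟨ coeffP-∷-*P-suc a p q j ⟩
  a *ℤ coeffP q (suc j) +ℤ coeffP (p *P q) j
    ≡⟨ cong₂ _+ℤ_ (cong (a *ℤ_) (q₀ (suc j) (s≤s (ℕ.≤-trans (ℕ.m≤n+m d₂ d₁) d≤j))))
                  (*P-vanishesFrom d₁ d₂ p q (λ i d≤i → p₀ (suc i) (s≤s d≤i)) q₀ j d≤j) ⟩
  a *ℤ + 0 +ℤ + 0                              ≡⟨ cong (_+ℤ + 0) (ℤ.*-zeroʳ a) ⟩
  + 0                                          ∎

boundedAbove⇒vanishesFrom : ∀ u N p → Bounded above u (laurent N p) → VanishesFrom (suc u + N) p
boundedAbove⇒vanishesFrom u N p bounded j u+N<j = subst (λ i → coeffP p i ≡ + 0) t+N≡j (bounded t u≤t)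
  where
  t = j ∸ suc N
  t+N≡j : suc t + N ≡ j
  t+N≡j = trans (sym (ℕ.+-suc t N)) (ℕ.m∸n+n≡m (ℕ.≤-trans (s≤s (ℕ.m≤n+m N u)) u+N<j))
  u≤t : u ≤ t
  u≤t = subst (_≤ t) (ℕ.m+n∸n≡m u N) (ℕ.∸-monoˡ-≤ (suc N) u+N<j)

vanishesFrom⇒boundedAbove : ∀ u N p → VanishesFrom (suc u + N) p → Bounded above u (laurent N p)
vanishesFrom⇒boundedAbove u N p vanishes t u≤t = vanishes (suc t + N) (ℕ.+-monoˡ-≤ N (s≤s u≤t))

boundedAbove-mulL : ∀ u₁ u₂ A B → Bounded above u₁ A → Bounded above u₂ B → Bounded above (u₁ + u₂) (mulL A B)
boundedAbove-mulL u₁ u₂ (laurent N p) (laurent M q) A≤ B≤ =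
  vanishesFrom⇒boundedAbove (u₁ + u₂) (N + M) (p *P q)
    (subst (λ d → VanishesFrom d (p *P q)) (regroup u₁ N u₂ M)
      (*P-vanishesFrom (suc u₁ + N) (u₂ + M) p q
        (boundedAbove⇒vanishesFrom u₁ N p A≤) (boundedAbove⇒vanishesFrom u₂ M q B≤)))
  where
  regroup : ∀ a b c d → suc a + b + (c + d) ≡ suc (a + c) + (b + d)
  regroup = ℕ-Solver.solve-∀

VanishesBelow : ℕ → Poly → Set
VanishesBelow d p = ∀ j → j < d → coeffP p j ≡ + 0

*P-vanishesBelow : ∀ d₁ d₂ p q → VanishesBelow d₁ p → VanishesBelow d₂ q → VanishesBelow (d₁ + d₂) (p *P q)
*P-vanishesBelow d₁       d₂ []      q p₀ q₀ j       j<d       = refl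
*P-vanishesBelow zero     d₂ (a ∷ p) q p₀ q₀ zero    j<d       =
  trans (coeffP-∷-*P-zero a p q) (trans (cong (a *ℤ_) (q₀ 0 j<d)) (ℤ.*-zeroʳ a))
*P-vanishesBelow zero     d₂ (a ∷ p) q p₀ q₀ (suc j) j<d       = begin
  coeffP ((a ∷ p) *P q) (suc j)                ≡⟨ coeffP-∷-*P-suc a p q j ⟩
  a *ℤ coeffP q (suc j) +ℤ coeffP (p *P q) j
    ≡⟨ cong₂ _+ℤ_ (cong (a *ℤ_) (q₀ (suc j) j<d))
                  (*P-vanishesBelow zero d₂ p q (λ _ ()) q₀ j (ℕ.<-trans (ℕ.n<1+n j) j<d)) ⟩
  a *ℤ + 0 +ℤ + 0                              ≡⟨ cong (_+ℤ + 0) (ℤ.*-zeroʳ a) ⟩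
  + 0                                          ∎
*P-vanishesBelow (suc d₁) d₂ (a ∷ p) q p₀ q₀ zero    j<d       =
  trans (coeffP-∷-*P-zero a p q) (cong (_*ℤ coeffP q 0) (p₀ 0 (s≤s z≤n)))
*P-vanishesBelow (suc d₁) d₂ (a ∷ p) q p₀ q₀ (suc j) (s≤s j<d) =
  trans (coeffP-∷-*P-suc a p q j)
        (cong₂ _+ℤ_ (cong (_*ℤ coeffP q (suc j)) (p₀ 0 (s≤s z≤n)))
                    (*P-vanishesBelow d₁ d₂ p q (λ i i<d → p₀ (suc i) (s≤s i<d)) q₀ j j<d))

m<n∸o⇒m+o<n : ∀ {m} n o → m < n ∸ o → m + o < n
m<n∸o⇒m+o<n {m} n       zero    m<n   = subst (_< n) (sym (ℕ.+-identityʳ m)) m<n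
m<n∸o⇒m+o<n     (suc n) (suc o) m<n∸o = subst (_< suc n) (sym (ℕ.+-suc _ o)) (s≤s (m<n∸o⇒m+o<n n o m<n∸o))

boundedBelow⇒vanishesBelow : ∀ u N p → Bounded below u (laurent N p) → VanishesBelow (N ∸ u) p
boundedBelow⇒vanishesBelow u N p bounded j j<N∸u = subst (λ x → coeffAux p x ≡ + 0) N⊖[1+t]≡j (bounded t u≤t)
  where
  j+u<N : j + u < N
  j+u<N = m<n∸o⇒m+o<n N u j<N∸u
  j<N : j < N
  j<N = ℕ.≤-trans (s≤s (ℕ.m≤m+n j u)) j+u<N
  t = N ∸ suc j
  u≤t : u ≤ t
  u≤t = ℕ.m+n≤o⇒m≤o∸n u (subst (_≤ N) (ℕ.+-comm (suc j) u) j+u<N)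
  N⊖[1+t]≡j : N ⊖ suc t ≡ + j
  N⊖[1+t]≡j = begin
    N ⊖ suc (N ∸ suc j) ≡⟨ cong (N ⊖_) (sym (ℕ.+-∸-assoc 1 j<N)) ⟩
    N ⊖ (N ∸ j)         ≡⟨ ℤ.⊖-≥ (ℕ.m∸n≤m N j) ⟩
    + (N ∸ (N ∸ j))     ≡⟨ cong +_ (ℕ.m∸[m∸n]≡n (ℕ.<⇒≤ j<N)) ⟩
    + j                 ∎

vanishesBelow⇒boundedBelow : ∀ u N p → VanishesBelow (N ∸ u) p → Bounded below u (laurent N p)
vanishesBelow⇒boundedBelow u N p vanishes t u≤t with suc t ≤? N
... | yes t<N rewrite ℤ.⊖-≥ t<N = vanishes (N ∸ suc t) (ℕ.∸-monoʳ-< (s≤s u≤t) t<N)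
... | no  t≮N rewrite ℤ.⊖-< (ℕ.≰⇒> t≮N) | ℕ.+-∸-assoc 1 (ℕ.≤-pred (ℕ.≰⇒> t≮N)) = refl

∸-subadditive : ∀ m n o p → (m + n) ∸ (o + p) ≤ (m ∸ o) + (n ∸ p)
∸-subadditive m n o p = ℕ.m≤n+o⇒m∸n≤o (m + n) (o + p)
  (ℕ.≤-trans (ℕ.+-mono-≤ (ℕ.m≤n+m∸n m o) (ℕ.m≤n+m∸n n p)) (ℕ.≤-reflexive (regroup o (m ∸ o) p (n ∸ p))))
  where
  regroup : ∀ a b c d → a + b + (c + d) ≡ a + c + (b + d)
  regroup = ℕ-Solver.solve-∀

boundedBelow-mulL : ∀ u₁ u₂ A B → Bounded below u₁ A → Bounded below u₂ B → Bounded below (u₁ + u₂) (mulL A B)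
boundedBelow-mulL u₁ u₂ (laurent N p) (laurent M q) A≥ B≥ =
  vanishesBelow⇒boundedBelow (u₁ + u₂) (N + M) (p *P q) λ j j<d →
    *P-vanishesBelow (N ∸ u₁) (M ∸ u₂) p q
      (boundedBelow⇒vanishesBelow u₁ N p A≥) (boundedBelow⇒vanishesBelow u₂ M q B≥) j
      (ℕ.<-≤-trans j<d (∸-subadditive N M u₁ u₂))

⌊m/2⌋+⌊n/2⌋≤⌊m+n/2⌋ : ∀ m n → ⌊ m /2⌋ + ⌊ n /2⌋ ≤ ⌊ m + n /2⌋
⌊m/2⌋+⌊n/2⌋≤⌊m+n/2⌋ zero          n = ℕ.≤-refl
⌊m/2⌋+⌊n/2⌋≤⌊m+n/2⌋ (suc zero)    n = ℕ.⌊n/2⌋-mono (ℕ.n≤1+n n)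
⌊m/2⌋+⌊n/2⌋≤⌊m+n/2⌋ (suc (suc m)) n = s≤s (⌊m/2⌋+⌊n/2⌋≤⌊m+n/2⌋ m n)

coeffL-if-false : ∀ {P : Set} (P? : Dec P) A m → ¬ P → coeffL (if does P? then A else zeroL) m ≡ + 0
coeffL-if-false P? A m ¬p = trans (cong (λ b → coeffL (if b then A else zeroL) m) (dec-false P? ¬p)) (coeffL-zeroL m)

if-true : ∀ {P : Set} (P? : Dec P) A → P → (if does P? then A else zeroL) ≡ A
if-true P? A p = cong (λ b → if b then A else zeroL) (dec-true P? p)

geomTerm : Laurent → ℕ → ℕ → ℕ → Laurent
geomTerm c i n k = if does (i * k ≟ n) then powL c k else zeroL

geomS-1 : ∀ c n → geomS c 1 n ≈L powL c n
geomS-1 c n m = begin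
  coeffL (geomS c 1 n) m                       ≡⟨ coeffL-sumL (geomTerm c 1 n) id (suc n) m ⟩
  sumZ (λ k → coeffL (term k) m) (suc n)       ≡⟨ sumZ-last (λ k → coeffL (term k) m) n ⟩
  sumZ (λ k → coeffL (term k) m) n +ℤ coeffL (term n) m
    ≡⟨ cong₂ _+ℤ_ (sumZ-zero n λ k k<n → coeffL-if-false (1 * k ≟ n) (powL c k) m
                                              (λ k≡n → ℕ.<⇒≢ k<n (trans (sym (ℕ.*-identityˡ k)) k≡n)))
                  (cong (λ A → coeffL A m) (if-true (1 * n ≟ n) (powL c n) (ℕ.*-identityˡ n))) ⟩
  + 0 +ℤ coeffL (powL c n) m                   ≡⟨ ℤ.+-identityˡ _ ⟩
  coeffL (powL c n) m                          ∎
  where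
  term = geomTerm c 1 n

-- Truncating the product

OneBelow : ℕ → Series → Set
OneBelow K X = ∀ n → n < K → X n ≈L oneS n

oneBelow-mulS : ∀ K X Y → OneBelow K X → OneBelow K Y → OneBelow K (mulS X Y)
oneBelow-mulS K X Y X≈1 Y≈1 n n<K m = begin
  coeffL (mulS X Y n) m     ≡⟨ mulS-congˡ-upTo X n (λ j j≤n → Y≈1 j (ℕ.≤-<-trans j≤n n<K)) m ⟩
  coeffL (mulS X oneS n) m  ≡⟨ mulS-identityʳ X n m ⟩
  coeffL (X n) m            ≡⟨ X≈1 n n<K m ⟩
  coeffL (oneS n) m         ∎

oneBelow-powS : ∀ K X k → OneBelow K X → OneBelow K (powS X k)
oneBelow-powS K X zero    X≈1 n n<K m = refl
oneBelow-powS K X (suc k) X≈1 = oneBelow-mulS K X (powS X k) X≈1 (oneBelow-powS K X k X≈1)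

oneBelow-1+monoS : ∀ c i → OneBelow i (addS oneS (monoS c i))
oneBelow-1+monoS c i n n<i m =
  trans (coeffL-addL (oneS n) (monoS c i n) m)
        (trans (cong (coeffL (oneS n) m +ℤ_) (coeffL-if-false (n ≟ i) c m (ℕ.<⇒≢ n<i))) (ℤ.+-identityʳ _))

oneBelow-geomS : ∀ c i → OneBelow i (geomS c i)
oneBelow-geomS c i zero    0<i m =
  trans (coeffL-sumL (geomTerm c i 0) id 1 m)
        (trans (ℤ.+-identityʳ _) (cong (λ A → coeffL A m) (if-true (i * 0 ≟ 0) oneL (ℕ.*-zeroʳ i))))
oneBelow-geomS c i (suc n) n<i m =
  trans (coeffL-sumL (geomTerm c i (suc n)) id (suc (suc n)) m)
        (trans (sumZ-zero (suc (suc n)) λ k _ → coeffL-if-false (i * k ≟ suc n) (powL c k) m (i*k≢1+n k))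
               (sym (coeffL-zeroL m)))
  where
  i*k≢1+n : ∀ k → i * k ≢ suc n
  i*k≢1+n zero    i*0≡1+n = ℕ.0≢1+n (trans (sym (ℕ.*-zeroʳ i)) i*0≡1+n)
  i*k≢1+n (suc k) i*k≡1+n = ℕ.<⇒≱ n<i (subst (i ≤_) i*k≡1+n (ℕ.m≤m*n i (suc k)))

oneBelow-epsFactor : ∀ ε d i → OneBelow i (epsFactor ε d i)
oneBelow-epsFactor ε (+ d)     i = oneBelow-powS i _ d (oneBelow-1+monoS (constL ε) i)
oneBelow-epsFactor ε -[1+ d ] i = oneBelow-powS i _ (suc d) (oneBelow-geomS (constL (- ε)) i)

oneBelow-factor : ∀ a b c ε i → OneBelow i (factor a b c ε i)
oneBelow-factor a b c ε i =
  oneBelow-mulS i _ _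
    (oneBelow-mulS i _ _ (oneBelow-powS i _ (a i) (oneBelow-geomS zL i))
                         (oneBelow-powS i _ (b i) (oneBelow-geomS zinvL i)))
    (oneBelow-epsFactor ε (c i) i)

prodTo-stable : ∀ a b c ε N n → n ≤ N → prodTo a b c ε (suc N) n ≈L prodTo a b c ε N n
prodTo-stable a b c ε N n n≤N m = begin
  coeffL (mulS P (factor a b c ε (suc N)) n) m
    ≡⟨ mulS-congˡ-upTo P n (λ j j≤n → oneBelow-factor a b c ε (suc N) j (s≤s (ℕ.≤-trans j≤n n≤N))) m ⟩
  coeffL (mulS P oneS n) m                      ≡⟨ mulS-identityʳ P n m ⟩
  coeffL (P n) m                                ∎
  where
  P = prodTo a b c ε N

-- The argument for one side of the symmetry z ↔ z⁻¹

-- ι t is the exponent ±(t + 1) and ι′ t the exponent ±t; sh multiplies by −z^(±1), taking the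
-- coefficient at ι′ t to the one at ι t.
module Side
  (ι ι′ : ℕ → ℤ) (sh : Laurent → Laurent)
  (coeffL-sh : ∀ B t → coeffL (sh B) (ι t) ≡ - coeffL B (ι′ t))
  (sh-mulL : ∀ B Y → mulL (sh B) Y ≈L sh (mulL B Y))
  (mulL-sh : ∀ B Y → mulL B (sh Y) ≈L sh (mulL B Y))
  (bounded-mulL : ∀ u₁ u₂ A B → Bounded ι u₁ A → Bounded ι u₂ B → Bounded ι (u₁ + u₂) (mulL A B))
  (bounded-constL : ∀ c → Bounded ι 0 (constL c))
  where

  -- Multiplication of a series by 1 + sh·q, that is by 1 − z q or by 1 − z⁻¹ q.
  Δ : Series → Series
  Δ X zero    = X zero
  Δ X (suc n) = addL (X (suc n)) (sh (X n))

  Δ-zero : ∀ X {n} → n ≡ 0 → Δ X n ≡ X n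
  Δ-zero X refl = refl

  coeffL-Δ-suc : ∀ X n t → coeffL (Δ X (suc n)) (ι t) ≡ coeffL (X (suc n)) (ι t) - coeffL (X n) (ι′ t)
  coeffL-Δ-suc X n t =
    trans (coeffL-addL (X (suc n)) (sh (X n)) (ι t)) (cong (coeffL (X (suc n)) (ι t) +ℤ_) (coeffL-sh (X n) t))

  coeffL-Δ-suc-mulL : ∀ X B n t →
    coeffL (mulL (Δ X (suc n)) B) (ι t) ≡ coeffL (mulL (X (suc n)) B) (ι t) - coeffL (mulL (X n) B) (ι′ t)
  coeffL-Δ-suc-mulL X B n t =
    trans (mulL-distribʳ-addL (X (suc n)) (sh (X n)) B (ι t))
          (cong (coeffL (mulL (X (suc n)) B) (ι t) +ℤ_) (trans (sh-mulL (X n) B (ι t)) (coeffL-sh (mulL (X n) B) t)))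

  coeffL-mulL-Δ-suc : ∀ A Y n t →
    coeffL (mulL A (Δ Y (suc n))) (ι t) ≡ coeffL (mulL A (Y (suc n))) (ι t) - coeffL (mulL A (Y n)) (ι′ t)
  coeffL-mulL-Δ-suc A Y n t =
    trans (mulL-distribˡ-addL A (Y (suc n)) (sh (Y n)) (ι t))
          (cong (coeffL (mulL A (Y (suc n))) (ι t) +ℤ_) (trans (mulL-sh A (Y n) (ι t)) (coeffL-sh (mulL A (Y n)) t)))

  Δ-mulSˡ : ∀ X Y n t → coeffL (Δ (mulS X Y) n) (ι t) ≡ coeffL (mulS (Δ X) Y n) (ι t)
  Δ-mulSˡ X Y zero    t = refl
  Δ-mulSˡ X Y (suc n) t = begin
    coeffL (Δ (mulS X Y) (suc n)) (ι t)
      ≡⟨ coeffL-Δ-suc (mulS X Y) n t ⟩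
    coeffL (mulS X Y (suc n)) (ι t) - coeffL (mulS X Y n) (ι′ t)
      ≡⟨ cong₂ _-_ (coeffL-mulS X Y (suc n) (ι t)) (coeffL-mulS X Y n (ι′ t)) ⟩
    x₀ +ℤ sumZ f (suc n) - sumZ g (suc n)
      ≡⟨ ℤ.+-assoc x₀ (sumZ f (suc n)) (- sumZ g (suc n)) ⟩
    x₀ +ℤ (sumZ f (suc n) - sumZ g (suc n))
      ≡⟨ cong (x₀ +ℤ_) (trans (sumZ-cong (suc n) λ j _ → coeffL-Δ-suc-mulL X (Y (n ∸ j)) j t) (sumZ-- f g (suc n))) ⟨
    x₀ +ℤ sumZ (λ j → coeffL (mulL (Δ X (suc j)) (Y (n ∸ j))) (ι t)) (suc n)
      ≡⟨ coeffL-mulS (Δ X) Y (suc n) (ι t) ⟨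
    coeffL (mulS (Δ X) Y (suc n)) (ι t) ∎
    where
    x₀ = coeffL (mulL (X 0) (Y (suc n))) (ι t)
    f g : ℕ → ℤ
    f j = coeffL (mulL (X (suc j)) (Y (n ∸ j))) (ι t)
    g j = coeffL (mulL (X j) (Y (n ∸ j))) (ι′ t)

  Δ-mulSʳ : ∀ X Y n t → coeffL (Δ (mulS X Y) n) (ι t) ≡ coeffL (mulS X (Δ Y) n) (ι t)
  Δ-mulSʳ X Y zero    t = refl
  Δ-mulSʳ X Y (suc n) t = begin
    coeffL (Δ (mulS X Y) (suc n)) (ι t)
      ≡⟨ coeffL-Δ-suc (mulS X Y) n t ⟩
    coeffL (mulS X Y (suc n)) (ι t) - coeffL (mulS X Y n) (ι′ t)
      ≡⟨ cong₂ _-_ (trans (coeffL-mulS X Y (suc n) (ι t)) (sumZ-last f (suc n))) (coeffL-mulS X Y n (ι′ t)) ⟩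
    sumZ f (suc n) +ℤ f (suc n) - sumZ g (suc n)
      ≡⟨ right-comm (sumZ f (suc n)) (f (suc n)) (sumZ g (suc n)) ⟩
    (sumZ f (suc n) - sumZ g (suc n)) +ℤ f (suc n)
      ≡⟨ cong₂ _+ℤ_ (trans (sumZ-cong (suc n) term) (sumZ-- f g (suc n))) last ⟨
    sumZ h (suc n) +ℤ h (suc n)
      ≡⟨ trans (coeffL-mulS X (Δ Y) (suc n) (ι t)) (sumZ-last h (suc n)) ⟨
    coeffL (mulS X (Δ Y) (suc n)) (ι t) ∎
    where
    f g h : ℕ → ℤ
    f j = coeffL (mulL (X j) (Y (suc n ∸ j))) (ι t)
    g j = coeffL (mulL (X j) (Y (n ∸ j))) (ι′ t)
    h j = coeffL (mulL (X j) (Δ Y (suc n ∸ j))) (ι t)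
    right-comm : ∀ a b c → a +ℤ b - c ≡ a - c +ℤ b
    right-comm = solve-∀
    last : h (suc n) ≡ f (suc n)
    last = cong (λ B → coeffL (mulL (X (suc n)) B) (ι t)) (Δ-zero Y (ℕ.n∸n≡0 n))
    term : ∀ j → j < suc n → h j ≡ f j - g j
    term j j<1+n = begin
      coeffL (mulL (X j) (Δ Y (suc n ∸ j))) (ι t)      ≡⟨ cong (λ k → coeffL (mulL (X j) (Δ Y k)) (ι t)) 1+n∸j ⟩
      coeffL (mulL (X j) (Δ Y (suc (n ∸ j)))) (ι t)    ≡⟨ coeffL-mulL-Δ-suc (X j) Y (n ∸ j) t ⟩
      coeffL (mulL (X j) (Y (suc (n ∸ j)))) (ι t) - g j ≡⟨ cong (λ k → coeffL (mulL (X j) (Y k)) (ι t) - g j) 1+n∸j ⟨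
      f j - g j                                        ∎
      where
      1+n∸j : suc n ∸ j ≡ suc (n ∸ j)
      1+n∸j = ℕ.+-∸-assoc 1 (ℕ.≤-pred j<1+n)

  bounded-mono : ∀ {u u′ A} → u ≤ u′ → Bounded ι u A → Bounded ι u′ A
  bounded-mono u≤u′ A≤ t u′≤t = A≤ t (ℕ.≤-trans u≤u′ u′≤t)

  bounded-zeroL : ∀ u → Bounded ι u zeroL
  bounded-zeroL u t _ = coeffL-zeroL (ι t)

  bounded-addL : ∀ {u A B} → Bounded ι u A → Bounded ι u B → Bounded ι u (addL A B)
  bounded-addL {u} {A} {B} A≤ B≤ t u≤t = trans (coeffL-addL A B (ι t)) (cong₂ _+ℤ_ (A≤ t u≤t) (B≤ t u≤t))

  bounded-if : ∀ {P : Set} {u A} (P? : Dec P) → (P → Bounded ι u A) → Bounded ι u (if does P? then A else zeroL)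
  bounded-if         (yes p) A≤ = A≤ p
  bounded-if {u = u} (no ¬p) A≤ = bounded-zeroL u

  bounded-sumL : ∀ {u} (h : ℕ → Laurent) g k → (∀ j → Bounded ι u (h (g j))) → Bounded ι u (sumL (map h (applyUpTo g k)))
  bounded-sumL h g k h≤ t u≤t = trans (coeffL-sumL h g k (ι t)) (sumZ-zero k λ j _ → h≤ j t u≤t)

  bounded-powL : ∀ {u} c k → Bounded ι u c → Bounded ι (k * u) (powL c k)
  bounded-powL c zero    c≤ = bounded-constL (+ 1)
  bounded-powL c (suc k) c≤ = bounded-mulL _ _ c (powL c k) c≤ (bounded-powL c k c≤)

  HalfBounded : Series → Set
  HalfBounded X = ∀ n → Bounded ι ⌊ n /2⌋ (X n)

  halfBounded-mulS : ∀ X Y → HalfBounded X → HalfBounded Y → HalfBounded (mulS X Y)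
  halfBounded-mulS X Y X≤ Y≤ n t n/2≤t = trans (coeffL-mulS X Y n (ι t)) (sumZ-zero (suc n) λ j j≤n →
    bounded-mulL _ _ (X j) (Y (n ∸ j)) (X≤ j) (Y≤ (n ∸ j)) t (ℕ.≤-trans (halves j j≤n) n/2≤t))
    where
    halves : ∀ j → j < suc n → ⌊ j /2⌋ + ⌊ n ∸ j /2⌋ ≤ ⌊ n /2⌋
    halves j j≤n = subst (λ k → ⌊ j /2⌋ + ⌊ n ∸ j /2⌋ ≤ ⌊ k /2⌋) (ℕ.m+[n∸m]≡n (ℕ.≤-pred j≤n))
                         (⌊m/2⌋+⌊n/2⌋≤⌊m+n/2⌋ j (n ∸ j))

  halfBounded-oneS : HalfBounded oneS
  halfBounded-oneS zero    = bounded-constL (+ 1)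
  halfBounded-oneS (suc n) = bounded-zeroL _

  halfBounded-powS : ∀ X k → HalfBounded X → HalfBounded (powS X k)
  halfBounded-powS X zero    X≤ = halfBounded-oneS
  halfBounded-powS X (suc k) X≤ = halfBounded-mulS X (powS X k) X≤ (halfBounded-powS X k X≤)

  halfBounded-addS : ∀ X Y → HalfBounded X → HalfBounded Y → HalfBounded (addS X Y)
  halfBounded-addS X Y X≤ Y≤ n = bounded-addL (X≤ n) (Y≤ n)

  halfBounded-monoS : ∀ c i → Bounded ι 0 c → HalfBounded (monoS c i)
  halfBounded-monoS c i c≤ n = bounded-if (n ≟ i) λ _ → bounded-mono z≤n c≤

  halfBounded-geomS : ∀ c i → (∀ k → Bounded ι ⌊ i * k /2⌋ (powL c k)) → HalfBounded (geomS c i)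
  halfBounded-geomS c i cᵏ≤ n =
    bounded-sumL (geomTerm c i n) id (suc n) λ k → bounded-if (i * k ≟ n) λ { refl → cᵏ≤ k }

  halfBounded-geomS-const : ∀ c i → Bounded ι 0 c → HalfBounded (geomS c i)
  halfBounded-geomS-const c i c≤ = halfBounded-geomS c i λ k →
    bounded-mono z≤n (subst (λ u → Bounded ι u (powL c k)) (ℕ.*-zeroʳ k) (bounded-powL c k c≤))

  -- For i ≥ 2 the power c^k sits at q^(i k), and i k / 2 ≥ k.
  halfBounded-geomS-≥2 : ∀ c i → 2 ≤ i → Bounded ι 1 c → HalfBounded (geomS c i)
  halfBounded-geomS-≥2 c i 2≤i c≤ = halfBounded-geomS c i λ k →
    bounded-mono (k≤⌊ik/2⌋ k) (subst (λ u → Bounded ι u (powL c k)) (ℕ.*-identityʳ k) (bounded-powL c k c≤))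
    where
    k≤⌊ik/2⌋ : ∀ k → k ≤ ⌊ i * k /2⌋
    k≤⌊ik/2⌋ k = subst (_≤ ⌊ i * k /2⌋) (sym (ℕ.n≡⌊n+n/2⌋ k))
      (ℕ.⌊n/2⌋-mono (subst (_≤ i * k) (cong (λ m → k + m) (ℕ.+-identityʳ k)) (ℕ.*-monoˡ-≤ k 2≤i)))

  halfBounded-epsFactor : ∀ ε d i → HalfBounded (epsFactor ε d i)
  halfBounded-epsFactor ε (+ d)     i =
    halfBounded-powS _ d (halfBounded-addS oneS _ halfBounded-oneS (halfBounded-monoS (constL ε) i (bounded-constL ε)))
  halfBounded-epsFactor ε -[1+ d ] i =
    halfBounded-powS _ (suc d) (halfBounded-geomS-const (constL (- ε)) i (bounded-constL (- ε)))

  halfBounded-factor : ∀ a b c ε i → HalfBounded (geomS zL i) → HalfBounded (geomS zinvL i) → HalfBounded (factor a b c ε i)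
  halfBounded-factor a b c ε i G≤ H≤ =
    halfBounded-mulS _ _ (halfBounded-mulS _ _ (halfBounded-powS _ (a i) G≤) (halfBounded-powS _ (b i) H≤))
                         (halfBounded-epsFactor ε (c i) i)

  halfBounded-Δ-mulSˡ : ∀ X Y → HalfBounded (Δ X) → HalfBounded Y → HalfBounded (Δ (mulS X Y))
  halfBounded-Δ-mulSˡ X Y ΔX≤ Y≤ n t n/2≤t = trans (Δ-mulSˡ X Y n t) (halfBounded-mulS (Δ X) Y ΔX≤ Y≤ n t n/2≤t)

  halfBounded-Δ-mulSʳ : ∀ X Y → HalfBounded X → HalfBounded (Δ Y) → HalfBounded (Δ (mulS X Y))
  halfBounded-Δ-mulSʳ X Y X≤ ΔY≤ n t n/2≤t = trans (Δ-mulSʳ X Y n t) (halfBounded-mulS X (Δ Y) X≤ ΔY≤ n t n/2≤t)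

  -- If multiplying by v shifts coefficients from ι′ t to ι t, then Δ cancels the series of 1/(1 − v q).
  halfBounded-Δ-geomS-1 : ∀ v → (∀ B t → coeffL (mulL v B) (ι t) ≡ coeffL B (ι′ t)) → HalfBounded (Δ (geomS v 1))
  halfBounded-Δ-geomS-1 v v-shifts zero    t _ = trans (geomS-1 v 0 (ι t)) (bounded-constL (+ 1) t z≤n)
  halfBounded-Δ-geomS-1 v v-shifts (suc n) t _ = begin
    coeffL (Δ (geomS v 1) (suc n)) (ι t)                           ≡⟨ coeffL-Δ-suc (geomS v 1) n t ⟩
    coeffL (geomS v 1 (suc n)) (ι t) - coeffL (geomS v 1 n) (ι′ t)  ≡⟨ cong₂ _-_ (geomS-1 v (suc n) (ι t)) (geomS-1 v n (ι′ t)) ⟩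
    coeffL (mulL v (powL v n)) (ι t) - coeffL (powL v n) (ι′ t)     ≡⟨ cong (_- coeffL (powL v n) (ι′ t)) (v-shifts (powL v n) t) ⟩
    coeffL (powL v n) (ι′ t) - coeffL (powL v n) (ι′ t)             ≡⟨ ℤ.+-inverseʳ (coeffL (powL v n) (ι′ t)) ⟩
    + 0                                                             ∎

  halfBounded-Δ-powS-geomS-1 : ∀ v k → (∀ B t → coeffL (mulL v B) (ι t) ≡ coeffL B (ι′ t)) → k ≡ 1 →
    HalfBounded (Δ (powS (geomS v 1) k))
  halfBounded-Δ-powS-geomS-1 v .1 v-shifts refl =
    halfBounded-Δ-mulSˡ (geomS v 1) oneS (halfBounded-Δ-geomS-1 v v-shifts) halfBounded-oneS

  -- Δ (f₁ f₂ ⋯ f_N) = (Δ f₁) f₂ ⋯ f_N.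
  halfBounded-Δ-prodTo : ∀ a b c ε → HalfBounded (Δ (factor a b c ε 1)) →
    (∀ i → 2 ≤ i → HalfBounded (factor a b c ε i)) → ∀ N → HalfBounded (Δ (prodTo a b c ε (suc N)))
  halfBounded-Δ-prodTo a b c ε Δf₁≤ fᵢ≤ zero    =
    halfBounded-Δ-mulSʳ oneS (factor a b c ε 1) halfBounded-oneS Δf₁≤
  halfBounded-Δ-prodTo a b c ε Δf₁≤ fᵢ≤ (suc N) =
    halfBounded-Δ-mulSˡ (prodTo a b c ε (suc N)) (factor a b c ε (suc (suc N)))
      (halfBounded-Δ-prodTo a b c ε Δf₁≤ fᵢ≤ N) (fᵢ≤ (suc (suc N)) (s≤s (s≤s z≤n)))

  coeffL-stable : ∀ X → HalfBounded (Δ X) →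
    ∀ n t → ⌊ suc n /2⌋ ≤ t → coeffL (X n) (ι′ t) ≡ coeffL (X (suc n)) (ι t)
  coeffL-stable X ΔX≤ n t n/2≤t =
    sym (ℤ.i-j≡0⇒i≡j _ _ (trans (sym (coeffL-Δ-suc X n t)) (ΔX≤ (suc n) t n/2≤t)))

  F-coeffL-stable : ∀ a b c ε → HalfBounded (Δ (factor a b c ε 1)) → (∀ i → 2 ≤ i → HalfBounded (factor a b c ε i)) →
    ∀ n t → ⌊ suc n /2⌋ ≤ t → coeffL (F a b c ε n) (ι′ t) ≡ coeffL (F a b c ε (suc n)) (ι t)
  F-coeffL-stable a b c ε Δf₁≤ fᵢ≤ n t n/2≤t =
    trans (sym (prodTo-stable a b c ε n n ℕ.≤-refl (ι′ t)))
          (coeffL-stable (prodTo a b c ε (suc n)) (halfBounded-Δ-prodTo a b c ε Δf₁≤ fᵢ≤ n) n t n/2≤t)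

module Above = Side above (λ t → + t) negZ coeffL-negZ negZ-mulL mulL-negZ boundedAbove-mulL (λ c t _ → refl)
module Below = Side below (λ t → - (+ t)) negZ⁻¹ coeffL-negZ⁻¹ negZ⁻¹-mulL mulL-negZ⁻¹ boundedBelow-mulL (λ c t _ → refl)

zL-boundedAbove : Bounded above 1 zL
zL-boundedAbove (suc t) _ = refl

zinvL-boundedAbove : Bounded above 0 zinvL
zinvL-boundedAbove t _ = refl

zL-boundedBelow : Bounded below 0 zL
zL-boundedBelow t _ = refl

zinvL-boundedBelow : Bounded below 1 zinvL
zinvL-boundedBelow (suc t) _ = refl

F-top-coeffL-stable : ∀ a b c ε → a 1 ≡ 1 → ∀ n t → ⌊ suc n /2⌋ ≤ t →
  coeffL (F a b c ε n) (+ t) ≡ coeffL (F a b c ε (suc n)) (+ suc t)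
F-top-coeffL-stable a b c ε a₁ = Above.F-coeffL-stable a b c ε Δf₁≤ fᵢ≤
  where
  open Above
  Δf₁≤ : HalfBounded (Δ (factor a b c ε 1))
  Δf₁≤ = halfBounded-Δ-mulSˡ _ _
    (halfBounded-Δ-mulSˡ _ _ (halfBounded-Δ-powS-geomS-1 zL (a 1) coeffL-zL-mulL a₁)
                             (halfBounded-powS _ (b 1) (halfBounded-geomS-const zinvL 1 zinvL-boundedAbove)))
    (halfBounded-epsFactor ε (c 1) 1)
  fᵢ≤ : ∀ i → 2 ≤ i → HalfBounded (factor a b c ε i)
  fᵢ≤ i 2≤i = halfBounded-factor a b c ε i (halfBounded-geomS-≥2 zL i 2≤i zL-boundedAbove)
                                           (halfBounded-geomS-const zinvL i zinvL-boundedAbove)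

F-bottom-coeffL-stable : ∀ a b c ε → b 1 ≡ 1 → ∀ n t → ⌊ suc n /2⌋ ≤ t →
  coeffL (F a b c ε n) (- (+ t)) ≡ coeffL (F a b c ε (suc n)) (- (+ suc t))
F-bottom-coeffL-stable a b c ε b₁ = Below.F-coeffL-stable a b c ε Δf₁≤ fᵢ≤
  where
  open Below
  Δf₁≤ : HalfBounded (Δ (factor a b c ε 1))
  Δf₁≤ = halfBounded-Δ-mulSˡ _ _
    (halfBounded-Δ-mulSʳ _ _ (halfBounded-powS _ (a 1) (halfBounded-geomS-const zL 1 zL-boundedBelow))
                             (halfBounded-Δ-powS-geomS-1 zinvL (b 1) coeffL-zinvL-mulL b₁))
    (halfBounded-epsFactor ε (c 1) 1)
  fᵢ≤ : ∀ i → 2 ≤ i → HalfBounded (factor a b c ε i)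
  fᵢ≤ i 2≤i = halfBounded-factor a b c ε i (halfBounded-geomS-const zL i zL-boundedBelow)
                                           (halfBounded-geomS-≥2 zinvL i 2≤i zinvL-boundedBelow)

⌊1+[n+n]/2⌋≡n : ∀ n → ⌊ suc (n + n) /2⌋ ≡ n
⌊1+[n+n]/2⌋≡n zero    = refl
⌊1+[n+n]/2⌋≡n (suc n) = cong suc (trans (cong ⌊_/2⌋ (ℕ.+-suc n n)) (⌊1+[n+n]/2⌋≡n n))

⌊1+n/2⌋≤n∸k : ∀ n k → 2 * k ≤ n → ⌊ suc n /2⌋ ≤ n ∸ k
⌊1+n/2⌋≤n∸k n k 2k≤n = subst (⌊ suc n /2⌋ ≤_) (⌊1+[n+n]/2⌋≡n t) (ℕ.⌊n/2⌋-mono (s≤s n≤t+t))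
  where
  t = n ∸ k
  k+k≤n : k + k ≤ n
  k+k≤n = subst (_≤ n) (cong (λ m → k + m) (ℕ.+-identityʳ k)) 2k≤n
  k+t≡n : k + t ≡ n
  k+t≡n = ℕ.m+[n∸m]≡n (ℕ.≤-trans (ℕ.m≤m+n k k) k+k≤n)
  n≤t+t : n ≤ t + t
  n≤t+t = subst (_≤ t + t) k+t≡n (ℕ.+-monoˡ-≤ t (ℕ.+-cancelˡ-≤ k k t (subst (k + k ≤_) (sym k+t≡n) k+k≤n)))

theorem11 : (a b : ℕ → ℕ) (c : ℕ → ℤ) (ε : ℤ) →
    a 1 ≡ 1 → b 1 ≡ 1 → (ε ≡ + 1 ⊎ ε ≡ -[1+ 0 ]) →
    (n k : ℕ) → 2 * k ≤ n →
    (coeffL (F a b c ε n) (+ (n ∸ k)) ≡ coeffL (F a b c ε (suc n)) (+ (suc n ∸ k)))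
    × (coeffL (F a b c ε n) (- (+ (n ∸ k))) ≡ coeffL (F a b c ε (suc n)) (- (+ (suc n ∸ k))))
theorem11 a b c ε a₁ b₁ _ n k 2k≤n rewrite ℕ.+-∸-assoc 1 (ℕ.≤-trans (ℕ.m≤n*m k 2) 2k≤n) =
  F-top-coeffL-stable a b c ε a₁ n (n ∸ k) (⌊1+n/2⌋≤n∸k n k 2k≤n) ,
  F-bottom-coeffL-stable a b c ε b₁ n (n ∸ k) (⌊1+n/2⌋≤n∸k n k 2k≤n)
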